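{- Let $a,b,c$ be positive integers such that $Q^{abc}=1+x^a(x+1)^b(1+x+x^2)^c$ is irreducible over $\mathbb{F}_2$, and suppose $(Q^{abc})^*=1+x^d(x+1)^e$ for some positive integers $d,e$. If $a$ is even and $b$ is odd, then $b=c=1$, $d=3$ and $a=e=2^r$ for some nonnegative integer $r$.
   Context: Here $Q=1+x+x^2$ and $P^*(x):=x^{\deg P}P(1/x)$ is the reciprocal of $P\in\mathbb{F}_2[x]$; thus $(Q^{abc})^*=x^{a+b+2c}+(x+1)^b(x^2+x+1)^c$. -}

module Defs where

open import Data.Bool using (Bool; true; false; _xor_; _∧_)
open import Data.List using (List; []; _∷_; reverse; length)
open import Data.Nat using (ℕ; zero; suc; _∸_)
open import Data.Sum using (_⊎_)
open import Data.Product using (_×_)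
open import Data.Nat using (_≥_)
open import Relation.Binary.PropositionalEquality using (_≡_)

-- Polynomials over F₂ as coefficient lists, lowest degree first
-- (true = 1, false = 0).  Trailing zeros are allowed; equality of
-- polynomials is equality after stripping trailing zeros.
F2Poly : Set
F2Poly = List Bool

norm : F2Poly → F2Poly
norm [] = []
norm (c ∷ p) with norm p
... | []    with c
...   | true  = true ∷ []
...   | false = []
norm (c ∷ p) | q ∷ qs = c ∷ q ∷ qs

_≈_ : F2Poly → F2Poly → Set
p ≈ q = norm p ≡ norm q

infix 4 _≈_
infixl 6 _⊕_
infixl 7 _⊗_ _·_
infixr 8 _^^_

_⊕_ : F2Poly → F2Poly → F2Poly
[] ⊕ q = q
(a ∷ p) ⊕ [] = a ∷ p
(a ∷ p) ⊕ (b ∷ q) = (a xor b) ∷ (p ⊕ q)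

_·_ : Bool → F2Poly → F2Poly
c · [] = []
c · (a ∷ p) = (c ∧ a) ∷ (c · p)

_⊗_ : F2Poly → F2Poly → F2Poly
[] ⊗ q = []
(a ∷ p) ⊗ q = (a · q) ⊕ (false ∷ (p ⊗ q))

one : F2Poly
one = true ∷ []

X : F2Poly
X = false ∷ true ∷ []

_^^_ : F2Poly → ℕ → F2Poly
p ^^ zero = one
p ^^ suc n = p ⊗ (p ^^ n)

-- degree (degree of the zero polynomial is taken to be 0; unused)
deg : F2Poly → ℕ
deg p = length (norm p) ∸ 1

-- reciprocal P*(x) = x^{deg P} P(1/x)
reciprocal : F2Poly → F2Poly
reciprocal p = reverse (norm p)

-- irreducible over F₂: positive degree, and in any factorisation one
-- factor is a unit (the only unit of F₂[x] is 1)
Irreducible : F2Poly → Set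
Irreducible p = deg p ≥ 1 × (∀ f g → p ≈ f ⊗ g → f ≈ one ⊎ g ≈ one)

Q : F2Poly
Q = true ∷ true ∷ true ∷ []

Qabc : ℕ → ℕ → ℕ → F2Poly
Qabc a b c = one ⊕ (X ^^ a) ⊗ ((X ⊕ one) ^^ b) ⊗ (Q ^^ c)

-- S = (x+1)^b Q^c is a palindrome of degree s = b + 2c, hence the
-- reciprocal of P = 1 + x^a S is S + x^n with n = a + s.  Everything follows
-- by comparing the coefficients of S + x^n with those of R, whose
-- coefficients above x^d are the binomial coefficients (e choose j) mod 2:
--   * the top degrees give d + e = n, and the vanishing coefficient of
--     x^{n-1} (here a ≥ 2 is used) makes e even;
--   * the lowest non-constant term of S is x^d; palindromy of S, the
--     oddness of s and the evenness of e then force s = d, hence e = a;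
--   * the gap between x^s and x^n kills every (e choose j), 0 < j < e, so
--     e is a power of 2;
--   * S = 1 + x^s, so (x+1)^{b-1} Q^c = 1 + x + … + x^{s-1}; evaluating at 1
--     gives b = 1, and the coefficients of x^2, x^3 of Q^c give c = 1.
-- The file first develops a small coefficient calculus for the list model
-- of F₂[x], then binomial coefficients mod 2, evaluation at 1, palindromes,
-- and reciprocals, and finally runs the comparison.
module Submission where

open import Defs
open import Algebra.Bundles using (CommutativeRing)
open import Data.Bool using (Bool; true; false; _xor_; _∧_; not)
open import Data.Bool.Properties
  using (xor-∧-commutativeRing; xor-same; xor-assoc; xor-comm; xor-identityʳ;
         ∧-distribˡ-xor; ∧-distribʳ-xor; ∧-zeroʳ; ∧-assoc; not-involutive)
open import Data.Empty using (⊥; ⊥-elim)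
open import Data.List using (List; []; _∷_; reverse; length; _++_)
open import Data.List.Properties using (unfold-reverse; length-reverse)
open import Data.Nat using (ℕ; zero; suc; _+_; _∸_; _*_; _^_; _≤_; _<_; _≥_; z≤n; s≤s; _≤?_; >-nonZero)
open import Data.Nat.Divisibility using (_∣_; divides; ∣⇒≤)
open import Data.Nat.Properties
open import Data.Product using (_×_; _,_; proj₁; proj₂; ∃)
open import Data.Sum using (_⊎_; inj₁; inj₂)
open import Relation.Binary.PropositionalEquality
open import Relation.Nullary using (¬_; yes; no)
open import Algebra.Properties.CommutativeSemigroup
  (CommutativeRing.+-commutativeSemigroup xor-∧-commutativeRing) using (interchange)

open ≡-Reasoning

false≢true : false ≡ true → ⊥
false≢true ()

xor-interchange : ∀ x y z w → (x xor y) xor (z xor w) ≡ (x xor z) xor (y xor w)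
xor-interchange = interchange

coef : F2Poly → ℕ → Bool
coef []      k       = false
coef (a ∷ p) zero    = a
coef (a ∷ p) (suc k) = coef p k

shift : (ℕ → Bool) → ℕ → Bool
shift f zero    = false
shift f (suc k) = f k

coef-norm : ∀ p k → coef (norm p) k ≡ coef p k
coef-norm [] k = refl
coef-norm (c ∷ p) k with norm p | coef-norm p
... | [] | ih with c
...   | true with k
...     | zero  = refl
...     | suc k = ih k
coef-norm (c ∷ p) k | [] | ih | false with k
...     | zero  = refl
...     | suc k = ih k
coef-norm (c ∷ p) k | q ∷ qs | ih with k
...     | zero  = refl
...     | suc k = ih k

≈⇒coef : ∀ {p q} → p ≈ q → ∀ k → coef p k ≡ coef q k
≈⇒coef {p} {q} p≈q k =
  trans (sym (coef-norm p k)) (trans (cong (λ l → coef l k) p≈q) (coef-norm q k))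

coef-⊕ : ∀ p q k → coef (p ⊕ q) k ≡ coef p k xor coef q k
coef-⊕ []      q       k       = refl
coef-⊕ (a ∷ p) []      k       = sym (xor-identityʳ _)
coef-⊕ (a ∷ p) (b ∷ q) zero    = refl
coef-⊕ (a ∷ p) (b ∷ q) (suc k) = coef-⊕ p q k

coef-· : ∀ a p k → coef (a · p) k ≡ a ∧ coef p k
coef-· a []      k       = sym (∧-zeroʳ a)
coef-· a (x ∷ p) zero    = refl
coef-· a (x ∷ p) (suc k) = coef-· a p k

coef-x· : ∀ p k → coef (false ∷ p) k ≡ shift (coef p) k
coef-x· p zero    = refl
coef-x· p (suc k) = refl

coef-⊗ : ∀ a p q k → coef ((a ∷ p) ⊗ q) k ≡ (a ∧ coef q k) xor shift (coef (p ⊗ q)) k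
coef-⊗ a p q k =
  trans (coef-⊕ (a · q) (false ∷ (p ⊗ q)) k) (cong₂ _xor_ (coef-· a q k) (coef-x· (p ⊗ q) k))

coef-⊗-distribʳ : ∀ p q w k → coef ((p ⊕ q) ⊗ w) k ≡ coef (p ⊗ w) k xor coef (q ⊗ w) k
coef-⊗-distribʳ []      q       w k = refl
coef-⊗-distribʳ (a ∷ p) []      w k = sym (xor-identityʳ _)
coef-⊗-distribʳ (a ∷ p) (b ∷ q) w k = begin
    coef (((a xor b) ∷ (p ⊕ q)) ⊗ w) k
  ≡⟨ coef-⊗ (a xor b) (p ⊕ q) w k ⟩
    ((a xor b) ∧ coef w k) xor shift (coef ((p ⊕ q) ⊗ w)) k
  ≡⟨ cong₂ _xor_ (∧-distribʳ-xor (coef w k) a b) (shifted k) ⟩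
    ((a ∧ coef w k) xor (b ∧ coef w k)) xor (shift (coef (p ⊗ w)) k xor shift (coef (q ⊗ w)) k)
  ≡⟨ xor-interchange (a ∧ coef w k) (b ∧ coef w k) _ _ ⟩
    ((a ∧ coef w k) xor shift (coef (p ⊗ w)) k) xor ((b ∧ coef w k) xor shift (coef (q ⊗ w)) k)
  ≡⟨ sym (cong₂ _xor_ (coef-⊗ a p w k) (coef-⊗ b q w k)) ⟩
    coef ((a ∷ p) ⊗ w) k xor coef ((b ∷ q) ⊗ w) k
  ∎
  where
  shifted : ∀ k → shift (coef ((p ⊕ q) ⊗ w)) k ≡ shift (coef (p ⊗ w)) k xor shift (coef (q ⊗ w)) k
  shifted zero    = refl
  shifted (suc k) = coef-⊗-distribʳ p q w k

coef-·-⊗ : ∀ a p w k → coef ((a · p) ⊗ w) k ≡ a ∧ coef (p ⊗ w) k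
coef-·-⊗ a []      w k = sym (∧-zeroʳ a)
coef-·-⊗ a (x ∷ p) w k = begin
    coef (((a ∧ x) ∷ (a · p)) ⊗ w) k
  ≡⟨ coef-⊗ (a ∧ x) (a · p) w k ⟩
    ((a ∧ x) ∧ coef w k) xor shift (coef ((a · p) ⊗ w)) k
  ≡⟨ cong₂ _xor_ (∧-assoc a x (coef w k)) (shifted k) ⟩
    (a ∧ (x ∧ coef w k)) xor (a ∧ shift (coef (p ⊗ w)) k)
  ≡⟨ sym (∧-distribˡ-xor a _ _) ⟩
    a ∧ ((x ∧ coef w k) xor shift (coef (p ⊗ w)) k)
  ≡⟨ cong (a ∧_) (sym (coef-⊗ x p w k)) ⟩
    a ∧ coef ((x ∷ p) ⊗ w) k
  ∎
  where
  shifted : ∀ k → shift (coef ((a · p) ⊗ w)) k ≡ a ∧ shift (coef (p ⊗ w)) k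
  shifted zero    = sym (∧-zeroʳ a)
  shifted (suc k) = coef-·-⊗ a p w k

coef-⊗-assoc : ∀ u v w k → coef ((u ⊗ v) ⊗ w) k ≡ coef (u ⊗ (v ⊗ w)) k
coef-⊗-assoc []      v w k = refl
coef-⊗-assoc (a ∷ p) v w k = begin
    coef (((a · v) ⊕ (false ∷ (p ⊗ v))) ⊗ w) k
  ≡⟨ coef-⊗-distribʳ (a · v) (false ∷ (p ⊗ v)) w k ⟩
    coef ((a · v) ⊗ w) k xor coef ((false ∷ (p ⊗ v)) ⊗ w) k
  ≡⟨ cong₂ _xor_ (coef-·-⊗ a v w k) (coef-⊗ false (p ⊗ v) w k) ⟩
    (a ∧ coef (v ⊗ w) k) xor (false xor shift (coef ((p ⊗ v) ⊗ w)) k)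
  ≡⟨ cong ((a ∧ coef (v ⊗ w) k) xor_) (shifted k) ⟩
    (a ∧ coef (v ⊗ w) k) xor shift (coef (p ⊗ (v ⊗ w))) k
  ≡⟨ sym (coef-⊗ a p (v ⊗ w) k) ⟩
    coef ((a ∷ p) ⊗ (v ⊗ w)) k
  ∎
  where
  shifted : ∀ k → shift (coef ((p ⊗ v) ⊗ w)) k ≡ shift (coef (p ⊗ (v ⊗ w))) k
  shifted zero    = refl
  shifted (suc k) = coef-⊗-assoc p v w k

X⊕1 : F2Poly
X⊕1 = X ⊕ one

mulX⊕1 : (ℕ → Bool) → ℕ → Bool
mulX⊕1 f k = f k xor shift f k

mulQ : (ℕ → Bool) → ℕ → Bool
mulQ f k = (f k xor shift f k) xor shift (shift f) k

coef-one-above : ∀ k → 1 ≤ k → coef one k ≡ false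
coef-one-above (suc k) _ = refl

coef-one⊗ : ∀ w k → coef (one ⊗ w) k ≡ coef w k
coef-one⊗ w k = trans (coef-⊗ true [] w k) (trans (cong (coef w k xor_) (shift-zero k)) (xor-identityʳ _))
  where
  shift-zero : ∀ k → shift (λ _ → false) k ≡ false
  shift-zero zero    = refl
  shift-zero (suc k) = refl

shift-one⊗ : ∀ w k → shift (coef (one ⊗ w)) k ≡ shift (coef w) k
shift-one⊗ w zero    = refl
shift-one⊗ w (suc k) = coef-one⊗ w k

coef-X⊗ : ∀ w k → coef (X ⊗ w) k ≡ shift (coef w) k
coef-X⊗ w k = trans (coef-⊗ false one w k) (shift-one⊗ w k)

coef-X⊕1⊗ : ∀ w k → coef (X⊕1 ⊗ w) k ≡ mulX⊕1 (coef w) k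
coef-X⊕1⊗ w k = trans (coef-⊗ true one w k) (cong (coef w k xor_) (shift-one⊗ w k))

coef-Q⊗ : ∀ w k → coef (Q ⊗ w) k ≡ mulQ (coef w) k
coef-Q⊗ w k = trans (coef-⊗ true (true ∷ true ∷ []) w k)
  (trans (cong (coef w k xor_) (shifted k)) (sym (xor-assoc (coef w k) _ _)))
  where
  shifted : ∀ k → shift (coef (X⊕1 ⊗ w)) k ≡ shift (coef w) k xor shift (shift (coef w)) k
  shifted zero    = refl
  shifted (suc k) = coef-X⊕1⊗ w k

coef-Xᵃ⊗-high : ∀ a w j → coef (X ^^ a ⊗ w) (a + j) ≡ coef w j
coef-Xᵃ⊗-high zero    w j = coef-one⊗ w j
coef-Xᵃ⊗-high (suc a) w j = trans (coef-⊗-assoc X (X ^^ a) w (suc (a + j)))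
  (trans (coef-X⊗ (X ^^ a ⊗ w) (suc (a + j))) (coef-Xᵃ⊗-high a w j))

coef-Xᵃ⊗-low : ∀ a w k → k < a → coef (X ^^ a ⊗ w) k ≡ false
coef-Xᵃ⊗-low (suc a) w k k<1+a = trans (coef-⊗-assoc X (X ^^ a) w k)
  (trans (coef-X⊗ (X ^^ a ⊗ w) k) (shifted k k<1+a))
  where
  shifted : ∀ k → k < suc a → shift (coef (X ^^ a ⊗ w)) k ≡ false
  shifted zero    _         = refl
  shifted (suc k) (s≤s k<a) = coef-Xᵃ⊗-low a w k k<a

par : ℕ → Bool
par zero    = false
par (suc n) = not (par n)

par-double : ∀ m → par (m * 2) ≡ false
par-double zero    = refl
par-double (suc m) = trans (not-involutive _) (par-double m)

par-+-double : ∀ x m → par (x + m * 2) ≡ par x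
par-+-double zero    m = par-double m
par-+-double (suc x) m = cong not (par-+-double x m)

parity : ∀ n → ∃ (λ m → n ≡ m * 2) ⊎ ∃ (λ m → n ≡ suc (m * 2))
parity zero = inj₁ (0 , refl)
parity (suc n) with parity n
... | inj₁ (m , n≡2m)   = inj₂ (m , cong suc n≡2m)
... | inj₂ (m , n≡2m+1) = inj₁ (suc m , cong suc n≡2m+1)

even-if-par-false : ∀ n → par n ≡ false → ∃ (λ m → n ≡ m * 2)
even-if-par-false n p with parity n
... | inj₁ even = even
... | inj₂ (m , refl) = ⊥-elim (false≢true (trans (sym p) (cong not (par-double m))))

+-two-doubles : ∀ r d → r + (suc d + suc d) ≡ suc (suc (r + (d + d)))
+-two-doubles r d = trans (+-suc r (d + suc d)) (cong suc (trans (cong (r +_) (+-suc d d)) (+-suc r (d + d))))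

odd-minus-double : ∀ r d σ → r + (d + d) ≡ suc (σ * 2) → ∃ (λ ρ → r ≡ suc (ρ * 2))
odd-minus-double r zero    σ       eq = σ , trans (sym (+-identityʳ r)) eq
odd-minus-double r (suc d) zero    eq with suc-injective (trans (sym (+-two-doubles r d)) eq)
... | ()
odd-minus-double r (suc d) (suc σ) eq =
  odd-minus-double r d σ (suc-injective (suc-injective (trans (sym (+-two-doubles r d)) eq)))

binom : ℕ → ℕ → Bool
binom n       zero    = true
binom zero    (suc k) = false
binom (suc n) (suc k) = binom n (suc k) xor binom n k

coef-X⊕1^ : ∀ e k → coef (X⊕1 ^^ e) k ≡ binom e k
coef-X⊕1^ zero    zero    = refl
coef-X⊕1^ zero    (suc k) = refl
coef-X⊕1^ (suc e) zero    =
  trans (coef-X⊕1⊗ (X⊕1 ^^ e) zero) (trans (xor-identityʳ _) (coef-X⊕1^ e zero))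
coef-X⊕1^ (suc e) (suc k) =
  trans (coef-X⊕1⊗ (X⊕1 ^^ e) (suc k)) (cong₂ _xor_ (coef-X⊕1^ e (suc k)) (coef-X⊕1^ e k))

binom-above : ∀ n k → n < k → binom n k ≡ false
binom-above zero    (suc k) _         = refl
binom-above (suc n) (suc k) (s≤s n<k) =
  cong₂ _xor_ (binom-above n (suc k) (m<n⇒m<1+n n<k)) (binom-above n k n<k)

binom-diag : ∀ n → binom n n ≡ true
binom-diag zero    = refl
binom-diag (suc n) = cong₂ _xor_ (binom-above n (suc n) (n<1+n n)) (binom-diag n)

binom-one : ∀ n → binom n 1 ≡ par n
binom-one zero    = refl
binom-one (suc n) = trans (xor-comm (binom n 1) true) (cong not (binom-one n))

binom-codiag : ∀ n → binom (suc n) n ≡ par (suc n)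
binom-codiag zero    = refl
binom-codiag (suc n) = cong₂ _xor_ (binom-diag (suc n)) (binom-codiag n)

-- Lucas' theorem for the last binary digit: (2m choose 2i) ≡ (m choose i),
-- while (2m choose 2i+1) ≡ 0 (together with the odd-top companions).
mutual
  binom-even-even : ∀ m i → binom (m * 2) (i * 2) ≡ binom m i
  binom-even-even zero    zero    = refl
  binom-even-even zero    (suc i) = refl
  binom-even-even (suc m) zero    = refl
  binom-even-even (suc m) (suc i) = cong₂ _xor_ (binom-odd-even m (suc i)) (binom-odd-odd m i)

  binom-even-odd : ∀ m i → binom (m * 2) (suc (i * 2)) ≡ false
  binom-even-odd zero    i = refl
  binom-even-odd (suc m) i = trans (cong₂ _xor_ (binom-odd-odd m i) (binom-odd-even m i)) (xor-same (binom m i))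

  binom-odd-even : ∀ m i → binom (suc (m * 2)) (i * 2) ≡ binom m i
  binom-odd-even m zero    = refl
  binom-odd-even m (suc i) = trans (cong₂ _xor_ (binom-even-even m (suc i)) (binom-even-odd m i)) (xor-identityʳ _)

  binom-odd-odd : ∀ m i → binom (suc (m * 2)) (suc (i * 2)) ≡ binom m i
  binom-odd-odd m i = cong₂ _xor_ (binom-even-odd m i) (binom-even-even m i)

-- If (e choose j) is even for every 0 < j < e, then e is a power of 2:
-- (e choose 1) even makes e = 2m, and by Lucas m inherits the hypothesis.
-- The recursion is on a fuel bound F ≥ e.
power-of-two : ∀ e → 1 ≤ e → (∀ j → 0 < j → j < e → binom e j ≡ false) → ∃ (λ r → e ≡ 2 ^ r)
power-of-two e = halve e e ≤-refl
  where
  halve : ∀ F e → e ≤ F → 1 ≤ e → (∀ j → 0 < j → j < e → binom e j ≡ false) → ∃ (λ r → e ≡ 2 ^ r)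
  halve F       (suc zero)    _            _ _ = 0 , refl
  halve (suc F) (suc (suc e)) (s≤s e<F) _ middle
    with even-if-par-false (suc (suc e)) (trans (sym (binom-one (suc (suc e)))) (middle 1 (s≤s z≤n) (s≤s (s≤s z≤n))))
  ... | suc m , e≡2m with halve F (suc m) m<F (s≤s z≤n) middle′
    where
    m<F : suc m ≤ F
    m<F = ≤-trans (s≤s (subst (m ≤_) (sym (suc-injective (suc-injective e≡2m))) (m≤m*n m 2))) e<F
    middle′ : ∀ j → 0 < j → j < suc m → binom (suc m) j ≡ false
    middle′ j 0<j j<m = trans (sym (binom-even-even (suc m) j)) (subst (λ x → binom x (j * 2) ≡ false) e≡2m
      (middle (j * 2) (*-monoˡ-< 2 0<j) (subst (j * 2 <_) (sym e≡2m) (*-monoˡ-< 2 j<m))))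
  ... | r , m≡2ʳ = suc r , trans e≡2m (trans (cong (_* 2) m≡2ʳ) (*-comm (2 ^ r) 2))

ev1 : F2Poly → Bool
ev1 []      = false
ev1 (a ∷ p) = a xor ev1 p

ev1-⊕ : ∀ p q → ev1 (p ⊕ q) ≡ ev1 p xor ev1 q
ev1-⊕ []      q       = refl
ev1-⊕ (a ∷ p) []      = sym (xor-identityʳ _)
ev1-⊕ (a ∷ p) (b ∷ q) = trans (cong ((a xor b) xor_) (ev1-⊕ p q)) (xor-interchange a b (ev1 p) (ev1 q))

ev1-· : ∀ a p → ev1 (a · p) ≡ a ∧ ev1 p
ev1-· a []      = sym (∧-zeroʳ a)
ev1-· a (x ∷ p) = trans (cong ((a ∧ x) xor_) (ev1-· a p)) (sym (∧-distribˡ-xor a x (ev1 p)))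

ev1-⊗ : ∀ p q → ev1 (p ⊗ q) ≡ ev1 p ∧ ev1 q
ev1-⊗ []      q = refl
ev1-⊗ (a ∷ p) q = trans (ev1-⊕ (a · q) (false ∷ (p ⊗ q)))
  (trans (cong₂ _xor_ (ev1-· a q) (ev1-⊗ p q)) (sym (∧-distribʳ-xor (ev1 q) a (ev1 p))))

ev1-X⊕1^⊗ : ∀ k C → ev1 (X⊕1 ^^ k ⊗ C) ≡ true → k ≡ 0
ev1-X⊕1^⊗ zero    C _     = refl
ev1-X⊕1^⊗ (suc k) C at1≡1 = ⊥-elim (false≢true (begin
    false                              ≡⟨ cong (_∧ ev1 C) (sym (ev1-⊗ X⊕1 (X⊕1 ^^ k))) ⟩
    ev1 (X⊕1 ^^ suc k) ∧ ev1 C         ≡⟨ sym (ev1-⊗ (X⊕1 ^^ suc k) C) ⟩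
    ev1 (X⊕1 ^^ suc k ⊗ C)             ≡⟨ at1≡1 ⟩
    true                               ∎))

ev1-ones : ∀ l s → (∀ k → k < s → coef l k ≡ true) → (∀ k → s ≤ k → coef l k ≡ false) → ev1 l ≡ par s
ev1-ones []           zero    _   _    = refl
ev1-ones (a ∷ l)      zero    _   high with high 0 z≤n
... | refl = ev1-ones l zero (λ _ ()) (λ k _ → high (suc k) z≤n)
ev1-ones []           (suc s) low _    with low 0 (s≤s z≤n)
... | ()
ev1-ones (false ∷ l)  (suc s) low _    with low 0 (s≤s z≤n)
... | ()
ev1-ones (true ∷ l)   (suc s) low high =
  cong not (ev1-ones l s (λ k k<s → low (suc k) (s≤s k<s)) (λ k s≤k → high (suc k) (s≤s s≤k)))

Palindrome : ℕ → (ℕ → Bool) → Set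
Palindrome m f = (f m ≡ true) × (∀ k → m < k → f k ≡ false) × (∀ i j → i + j ≡ m → f i ≡ f j)

palindrome-ext : ∀ {m f g} → (∀ k → f k ≡ g k) → Palindrome m f → Palindrome m g
palindrome-ext {m} fg (top , above , mirror) =
  trans (sym (fg m)) top ,
  (λ k m<k → trans (sym (fg k)) (above k m<k)) ,
  (λ i j i+j≡m → trans (sym (fg i)) (trans (mirror i j i+j≡m) (fg j)))

palindrome-mulX⊕1 : ∀ {m f} → Palindrome m f → Palindrome (suc m) (mulX⊕1 f)
palindrome-mulX⊕1 {m} {f} (top , above , mirror) = top′ , above′ , mirror′
  where
  top′ : f (suc m) xor f m ≡ true
  top′ = cong₂ _xor_ (above (suc m) (n<1+n m)) top
  above′ : ∀ k → suc m < k → mulX⊕1 f k ≡ false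
  above′ (suc k) (s≤s m<k) = cong₂ _xor_ (above (suc k) (m<n⇒m<1+n m<k)) (above k m<k)
  mirror′ : ∀ i j → i + j ≡ suc m → mulX⊕1 f i ≡ mulX⊕1 f j
  mirror′ zero .(suc m) refl =
    trans (xor-identityʳ _) (trans (mirror 0 m refl) (sym (cong (_xor f m) (above (suc m) (n<1+n m)))))
  mirror′ (suc i) zero eq = begin
      f (suc i) xor f i  ≡⟨ cong (_xor f i) (above (suc i) (≤-reflexive (cong suc (sym i≡m)))) ⟩
      f i                ≡⟨ mirror i 0 (trans (+-identityʳ i) i≡m) ⟩
      f 0                ≡⟨ sym (xor-identityʳ _) ⟩
      f 0 xor false      ∎
    where
    i≡m : i ≡ m
    i≡m = trans (sym (+-identityʳ i)) (suc-injective eq)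
  mirror′ (suc i) (suc j) eq =
    trans (cong₂ _xor_ (mirror (suc i) j (trans (sym (+-suc i j)) (suc-injective eq))) (mirror i (suc j) (suc-injective eq)))
          (xor-comm (f j) (f (suc j)))

-- For a palindrome f of degree m, the coefficients of x and x^{m+1} in
-- (x²+x+1)·f agree (the boundary case of its mirror symmetry).
mulQ-mirror-one : ∀ m f → Palindrome m f → mulQ f 1 ≡ mulQ f (suc m)
mulQ-mirror-one zero     f _                    = refl
mulQ-mirror-one (suc m′) f (top , above , mirror) = begin
    (f 1 xor f 0) xor false
  ≡⟨ xor-identityʳ _ ⟩
    f 1 xor f 0
  ≡⟨ cong₂ _xor_ (mirror 1 m′ refl) (mirror 0 (suc m′) refl) ⟩
    f m′ xor f (suc m′)
  ≡⟨ xor-comm (f m′) (f (suc m′)) ⟩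
    (f (suc m′) xor f m′)
  ≡⟨ cong (λ u → (u xor f (suc m′)) xor f m′) (sym (above (suc (suc m′)) (n<1+n (suc m′)))) ⟩
    (f (suc (suc m′)) xor f (suc m′)) xor f m′
  ∎

xor-rotate : ∀ x y z → (x xor y) xor z ≡ (z xor y) xor x
xor-rotate false false false = refl
xor-rotate false false true  = refl
xor-rotate false true  false = refl
xor-rotate false true  true  = refl
xor-rotate true  false false = refl
xor-rotate true  false true  = refl
xor-rotate true  true  false = refl
xor-rotate true  true  true  = refl

palindrome-mulQ : ∀ {m f} → Palindrome m f → Palindrome (suc (suc m)) (mulQ f)
palindrome-mulQ {m} {f} pal@(top , above , mirror) = top′ , above′ , mirror′
  where
  g : ℕ → Bool
  g = mulQ f
  g-top : g (suc (suc m)) ≡ f m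
  g-top = cong₂ (λ u v → (u xor v) xor f m) (above (suc (suc m)) (s≤s (n≤1+n m))) (above (suc m) (n<1+n m))
  top′ : g (suc (suc m)) ≡ true
  top′ = trans g-top top
  above′ : ∀ k → suc (suc m) < k → g k ≡ false
  above′ (suc (suc k)) (s≤s (s≤s m<k)) =
    cong₂ _xor_ (cong₂ _xor_ (above (suc (suc k)) (m<n⇒m<1+n (m<n⇒m<1+n m<k))) (above (suc k) (m<n⇒m<1+n m<k)))
                (above k m<k)
  mirror-zero : g 0 ≡ g (suc (suc m))
  mirror-zero = trans (trans (xor-identityʳ _) (xor-identityʳ _)) (trans (mirror 0 m refl) (sym g-top))
  mirror′ : ∀ i j → i + j ≡ suc (suc m) → g i ≡ g j
  mirror′ zero          j             eq = subst (λ x → g 0 ≡ g x) (sym eq) mirror-zero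
  mirror′ (suc zero)    j             eq = subst (λ x → g 1 ≡ g x) (sym (suc-injective eq)) (mulQ-mirror-one m f pal)
  mirror′ (suc (suc i)) zero          eq = subst (λ x → g x ≡ g 0) (sym (trans (sym (+-identityʳ _)) eq)) (sym mirror-zero)
  mirror′ (suc (suc i)) (suc zero)    eq =
    subst (λ x → g x ≡ g 1) (sym (suc-injective (trans (+-comm 1 (suc (suc i))) eq))) (sym (mulQ-mirror-one m f pal))
  mirror′ (suc (suc i)) (suc (suc j)) eq =
    trans (cong₂ (λ u v → (u xor v) xor f i) (mirror (suc (suc i)) j e₁) (mirror (suc i) (suc j) e₂))
      (trans (cong ((f j xor f (suc j)) xor_) (mirror i (suc (suc j)) e₃)) (xor-rotate (f j) (f (suc j)) (f (suc (suc j)))))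
    where
    e₃ : i + suc (suc j) ≡ m
    e₃ = suc-injective (suc-injective eq)
    e₂ : suc i + suc j ≡ m
    e₂ = trans (sym (+-suc i (suc j))) e₃
    e₁ : suc (suc i) + j ≡ m
    e₁ = trans (sym (trans (+-suc i (suc j)) (cong suc (+-suc i j)))) e₃

palindrome-Q^ : ∀ c → Palindrome (c * 2) (coef (Q ^^ c))
palindrome-Q^ zero = refl , above , mirror
  where
  above : ∀ k → 0 < k → coef one k ≡ false
  above (suc k) _ = refl
  mirror : ∀ i j → i + j ≡ 0 → coef one i ≡ coef one j
  mirror zero zero _ = refl
palindrome-Q^ (suc c) = palindrome-ext (λ k → sym (coef-Q⊗ (Q ^^ c) k)) (palindrome-mulQ (palindrome-Q^ c))

palindrome-S : ∀ b c → Palindrome (b + c * 2) (coef (X⊕1 ^^ b ⊗ Q ^^ c))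
palindrome-S zero    c = palindrome-ext (λ k → sym (coef-one⊗ (Q ^^ c) k)) (palindrome-Q^ c)
palindrome-S (suc b) c = palindrome-ext
  (λ k → sym (trans (coef-⊗-assoc X⊕1 (X⊕1 ^^ b) (Q ^^ c) k) (coef-X⊕1⊗ (X⊕1 ^^ b ⊗ Q ^^ c) k)))
  (palindrome-mulX⊕1 (palindrome-S b c))

shift-no-odd : ∀ (f : ℕ → Bool) → (∀ i → f (suc (i * 2)) ≡ false) → ∀ i → shift f (i * 2) ≡ false
shift-no-odd f odd-zero zero    = refl
shift-no-odd f odd-zero (suc i) = odd-zero i

-- Q² = 1 + x² + x⁴ has only even terms, so multiplying twice by Q keeps
-- the odd coefficients zero.
mulQ²-keeps-even : ∀ (f w : ℕ → Bool) → (∀ i → f (suc (i * 2)) ≡ false) → (∀ k → w k ≡ mulQ f k) →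
  ∀ i → mulQ w (suc (i * 2)) ≡ false
mulQ²-keeps-even f w odd-zero w≡Qf zero rewrite w≡Qf 1 | w≡Qf 0 | odd-zero 0 = cancel (f 0)
  where
  cancel : ∀ x → (((false xor x) xor false) xor ((x xor false) xor false)) xor false ≡ false
  cancel false = refl
  cancel true  = refl
mulQ²-keeps-even f w odd-zero w≡Qf (suc i)
  rewrite w≡Qf (suc (suc (suc (i * 2)))) | w≡Qf (suc (suc (i * 2))) | w≡Qf (suc (i * 2))
        | odd-zero (suc i) | odd-zero i | shift-no-odd f odd-zero i
  = cancel (f (suc (suc (i * 2)))) (f (i * 2))
  where
  cancel : ∀ x y → ((((false xor x) xor false) xor ((x xor false) xor y)) xor ((false xor y) xor false)) ≡ false
  cancel false false = refl
  cancel false true  = refl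
  cancel true  false = refl
  cancel true  true  = refl

Q^even-odd-coef : ∀ j i → coef (Q ^^ (j * 2)) (suc (i * 2)) ≡ false
Q^even-odd-coef zero    i = refl
Q^even-odd-coef (suc j) i = trans (coef-Q⊗ (Q ⊗ Q ^^ (j * 2)) (suc (i * 2)))
  (mulQ²-keeps-even (coef (Q ^^ (j * 2))) (coef (Q ⊗ Q ^^ (j * 2))) (Q^even-odd-coef j) (coef-Q⊗ (Q ^^ (j * 2))) i)

-- (x²+x+1)^c = 1 + x + … + x^{2c} only for c = 1: for even c the
-- coefficient of x vanishes; for c = 2γ+1 with γ ≥ 1 the coefficients of
-- x² and x³ of Q·Q^{2γ} are v₂+1 and v₂, where v₂ is that of x² in Q^{2γ}.
Q^-all-ones : ∀ c → 1 ≤ c → (∀ k → k < suc (c * 2) → coef (Q ^^ c) k ≡ true) → c ≡ 1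
Q^-all-ones c c≥1 ones with parity c
Q^-all-ones .(zero * 2)  () ones | inj₁ (zero , refl)
Q^-all-ones .(suc γ * 2) _  ones | inj₁ (suc γ , refl) =
  ⊥-elim (false≢true (trans (sym (Q^even-odd-coef (suc γ) 0)) (ones 1 (s≤s (s≤s z≤n)))))
Q^-all-ones .(suc (zero * 2))  _ ones | inj₂ (zero , refl) = refl
Q^-all-ones .(suc (suc γ * 2)) _ ones | inj₂ (suc γ , refl) = ⊥-elim (contradiction (v 2) coef-x² coef-x³)
  where
  v : ℕ → Bool
  v = coef (Q ^^ (suc γ * 2))
  v-zero : v 0 ≡ true
  v-zero = trans (proj₂ (proj₂ (palindrome-Q^ (suc γ * 2))) 0 (suc γ * 2 * 2) refl) (proj₁ (palindrome-Q^ (suc γ * 2)))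
  coef-x² : (v 2 xor false) xor true ≡ true
  coef-x² = trans (cong₂ (λ x y → (v 2 xor x) xor y) (sym (Q^even-odd-coef (suc γ) 0)) (sym v-zero))
         (trans (sym (coef-Q⊗ (Q ^^ (suc γ * 2)) 2)) (ones 2 (s≤s (s≤s (s≤s z≤n)))))
  coef-x³ : (false xor v 2) xor false ≡ true
  coef-x³ = trans (cong₂ (λ x y → (x xor v 2) xor y) (sym (Q^even-odd-coef (suc γ) 1)) (sym (Q^even-odd-coef (suc γ) 0)))
         (trans (sym (coef-Q⊗ (Q ^^ (suc γ * 2)) 3)) (ones 3 (s≤s (s≤s (s≤s (s≤s z≤n))))))
  contradiction : ∀ v₂ → (v₂ xor false) xor true ≡ true → (false xor v₂) xor false ≡ true → ⊥
  contradiction false _ ()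
  contradiction true  () _

norm-zero : ∀ p → (∀ k → coef p k ≡ false) → norm p ≡ []
norm-zero []          _     = refl
norm-zero (true ∷ p)  zeros with zeros 0
... | ()
norm-zero (false ∷ p) zeros with norm p | norm-zero p (λ k → zeros (suc k))
... | [] | refl = refl

length-norm : ∀ p n → coef p n ≡ true → (∀ k → n < k → coef p k ≡ false) → length (norm p) ≡ suc n
length-norm (true ∷ p) zero refl above with norm p | norm-zero p (λ k → above (suc k) (s≤s z≤n))
... | [] | refl = refl
length-norm (c ∷ p) (suc n) top above with norm p | length-norm p n top (λ k n<k → above (suc k) (s≤s n<k))
... | q ∷ qs | len = cong suc len

coef-++-low : ∀ (m r : List Bool) k → k < length m → coef (m ++ r) k ≡ coef m k
coef-++-low (x ∷ m) r zero    _         = refl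
coef-++-low (x ∷ m) r (suc k) (s≤s k<m) = coef-++-low m r k k<m

coef-++-high : ∀ (m r : List Bool) j → coef (m ++ r) (length m + j) ≡ coef r j
coef-++-high []      r j = refl
coef-++-high (x ∷ m) r j = coef-++-high m r j

coef-beyond-length : ∀ (l : List Bool) k → length l ≤ k → coef l k ≡ false
coef-beyond-length []      k       _         = refl
coef-beyond-length (x ∷ l) (suc k) (s≤s l≤k) = coef-beyond-length l k l≤k

coef-reverse : ∀ l k → k < length l → coef (reverse l) k ≡ coef l (length l ∸ suc k)
coef-reverse (x ∷ l) k k<l rewrite unfold-reverse x l with m≤n⇒m<n∨m≡n (≤-pred k<l)
... | inj₁ k<L = trans (coef-++-low (reverse l) (x ∷ []) k (subst (k <_) (sym (length-reverse l)) k<L))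
       (trans (coef-reverse l k k<L) (sym (cong (coef (x ∷ l)) (+-∸-assoc 1 k<L))))
... | inj₂ refl = trans (cong (coef (reverse l ++ x ∷ [])) (sym (trans (+-identityʳ _) (length-reverse l))))
       (trans (coef-++-high (reverse l) (x ∷ []) 0) (cong (coef (x ∷ l)) (sym (n∸n≡0 (length l)))))

module _ (p : F2Poly) (n : ℕ) (top : coef p n ≡ true) (above : ∀ k → n < k → coef p k ≡ false) where

  coef-reciprocal : ∀ k → k ≤ n → coef (reciprocal p) k ≡ coef p (n ∸ k)
  coef-reciprocal k k≤n = begin
      coef (reverse (norm p)) k
    ≡⟨ coef-reverse (norm p) k (subst (k <_) (sym (length-norm p n top above)) (s≤s k≤n)) ⟩
      coef (norm p) (length (norm p) ∸ suc k)
    ≡⟨ cong (λ L → coef (norm p) (L ∸ suc k)) (length-norm p n top above) ⟩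
      coef (norm p) (n ∸ k)
    ≡⟨ coef-norm p (n ∸ k) ⟩
      coef p (n ∸ k)
    ∎

  coef-reciprocal-above : ∀ k → n < k → coef (reciprocal p) k ≡ false
  coef-reciprocal-above k n<k = coef-beyond-length (reverse (norm p)) k
    (subst (_≤ k) (sym (trans (length-reverse (norm p)) (length-norm p n top above))) n<k)

≤-if-coef-true : ∀ (f : ℕ → Bool) m k → (∀ j → m < j → f j ≡ false) → f k ≡ true → k ≤ m
≤-if-coef-true f m k above fk with k ≤? m
... | yes k≤m = k≤m
... | no  k≰m = ⊥-elim (false≢true (trans (sym (above k (≰⇒> k≰m))) fk))

module ReciprocalOfShiftedPalindrome
  (a s : ℕ) (S P : F2Poly) (a≥1 : 1 ≤ a) (pal : Palindrome s (coef S))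
  (coef-P : ∀ k → coef P k ≡ coef one k xor coef (X ^^ a ⊗ S) k) where

  n : ℕ
  n = a + s

  private
    P-high : ∀ j → coef P (a + j) ≡ coef S j
    P-high j = trans (coef-P (a + j))
      (cong₂ _xor_ (coef-one-above (a + j) (≤-trans a≥1 (m≤m+n a j))) (coef-Xᵃ⊗-high a S j))

    P-zero : coef P 0 ≡ true
    P-zero = trans (coef-P 0) (cong (true xor_) (coef-Xᵃ⊗-low a S 0 a≥1))

    P-top : coef P n ≡ true
    P-top = trans (P-high s) (proj₁ pal)

    P-above : ∀ k → n < k → coef P k ≡ false
    P-above k n<k = begin
        coef P k              ≡⟨ cong (coef P) (sym (m+[n∸m]≡n a≤k)) ⟩
        coef P (a + (k ∸ a))  ≡⟨ P-high (k ∸ a) ⟩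
        coef S (k ∸ a)        ≡⟨ proj₁ (proj₂ pal) (k ∸ a) (+-cancelˡ-< a s (k ∸ a) (subst (n <_) (sym (m+[n∸m]≡n a≤k)) n<k)) ⟩
        false                 ∎
      where
      a≤k : a ≤ k
      a≤k = ≤-trans (m≤m+n a s) (<⇒≤ n<k)

    coef-P* : ∀ k → k ≤ n → coef (reciprocal P) k ≡ coef P (n ∸ k)
    coef-P* = coef-reciprocal P n P-top P-above

  -- Below x^s the reciprocal reproduces S (by palindromy), then a gap,
  -- then the term x^n.
  recip-low : ∀ k → k ≤ s → coef (reciprocal P) k ≡ coef S k
  recip-low k k≤s = begin
      coef (reciprocal P) k     ≡⟨ coef-P* k (≤-trans k≤s (m≤n+m s a)) ⟩
      coef P (a + s ∸ k)        ≡⟨ cong (coef P) (+-∸-assoc a k≤s) ⟩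
      coef P (a + (s ∸ k))      ≡⟨ P-high (s ∸ k) ⟩
      coef S (s ∸ k)            ≡⟨ proj₂ (proj₂ pal) (s ∸ k) k (m∸n+n≡m k≤s) ⟩
      coef S k                  ∎

  recip-gap : ∀ k → s < k → k < n → coef (reciprocal P) k ≡ false
  recip-gap k s<k k<n = trans (coef-P* k (<⇒≤ k<n))
    (trans (coef-P (n ∸ k)) (cong₂ _xor_ (coef-one-above (n ∸ k) (m<n⇒0<n∸m k<n)) (coef-Xᵃ⊗-low a S (n ∸ k) n∸k<a)))
    where
    n∸k<a : n ∸ k < a
    n∸k<a = subst (n ∸ k <_) (m+n∸n≡m a s) (∸-monoʳ-< s<k (<⇒≤ k<n))

  recip-top : coef (reciprocal P) n ≡ true
  recip-top = trans (coef-P* n ≤-refl) (trans (cong (coef P) (n∸n≡0 n)) P-zero)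

  recip-above : ∀ k → n < k → coef (reciprocal P) k ≡ false
  recip-above = coef-reciprocal-above P n P-top P-above

module BinomialTail (d e : ℕ) (d≥1 : 1 ≤ d) where

  R : F2Poly
  R = one ⊕ X ^^ d ⊗ X⊕1 ^^ e

  R-low : ∀ k → 1 ≤ k → k < d → coef R k ≡ false
  R-low k k≥1 k<d = trans (coef-⊕ one (X ^^ d ⊗ X⊕1 ^^ e) k)
    (cong₂ _xor_ (coef-one-above k k≥1) (coef-Xᵃ⊗-low d (X⊕1 ^^ e) k k<d))

  R-high : ∀ j → coef R (d + j) ≡ binom e j
  R-high j = trans (coef-⊕ one (X ^^ d ⊗ X⊕1 ^^ e) (d + j))
    (cong₂ _xor_ (coef-one-above (d + j) (≤-trans d≥1 (m≤m+n d j)))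
                 (trans (coef-Xᵃ⊗-high d (X⊕1 ^^ e) j) (coef-X⊕1^ e j)))

coef-Qabc : ∀ a b c k → coef (Qabc a b c) k ≡ coef one k xor coef (X ^^ a ⊗ (X⊕1 ^^ b ⊗ Q ^^ c)) k
coef-Qabc a b c k = trans (coef-⊕ one ((X ^^ a ⊗ X⊕1 ^^ b) ⊗ Q ^^ c) k)
  (cong (coef one k xor_) (coef-⊗-assoc (X ^^ a) (X⊕1 ^^ b) (Q ^^ c) k))

-- Setting of the lemma, with the parity hypotheses in the form used:
-- a ≥ 2 (a is even and positive) and b = 2β + 1.
module Comparison
  (a b c d e : ℕ) (a≥2 : 2 ≤ a) (c≥1 : 1 ≤ c) (d≥1 : 1 ≤ d) (e≥1 : 1 ≤ e) (β : ℕ) (b-odd : b ≡ suc (β * 2))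
  (P*≈R : reciprocal (Qabc a b c) ≈ one ⊕ X ^^ d ⊗ X⊕1 ^^ e) where

  S : F2Poly
  S = X⊕1 ^^ b ⊗ Q ^^ c

  s : ℕ
  s = b + c * 2

  s-odd : s ≡ suc ((β + c) * 2)
  s-odd = trans (cong (_+ c * 2) b-odd) (cong suc (sym (*-distribʳ-+ 2 β c)))

  pal : Palindrome s (coef S)
  pal = palindrome-S b c

  open ReciprocalOfShiftedPalindrome a s S (Qabc a b c) (≤-trans (n≤1+n 1) a≥2) pal (coef-Qabc a b c)
  open BinomialTail d e d≥1

  agree : ∀ k → coef (reciprocal (Qabc a b c)) k ≡ coef R k
  agree = ≈⇒coef {reciprocal (Qabc a b c)} {R} P*≈R

  S-agree : ∀ k → k ≤ s → coef S k ≡ coef R k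
  S-agree k k≤s = trans (sym (recip-low k k≤s)) (agree k)

  degree-sum : d + e ≡ n
  degree-sum = ≤-antisym d+e≤n (subst (_≤ d + e) (m+[n∸m]≡n d≤n) (+-monoʳ-≤ d n∸d≤e))
    where
    R-top : coef R n ≡ true
    R-top = trans (sym (agree n)) recip-top
    n≥1 : 1 ≤ n
    n≥1 = ≤-trans (≤-trans (n≤1+n 1) a≥2) (m≤m+n a s)
    d≤n : d ≤ n
    d≤n with d ≤? n
    ... | yes d≤n = d≤n
    ... | no  d≰n = ⊥-elim (false≢true (trans (sym (R-low n n≥1 (≰⇒> d≰n))) R-top))
    n∸d≤e : n ∸ d ≤ e
    n∸d≤e = ≤-if-coef-true (binom e) e (n ∸ d) (binom-above e)
      (trans (sym (R-high (n ∸ d))) (trans (cong (coef R) (m+[n∸m]≡n d≤n)) R-top))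
    d+e≤n : d + e ≤ n
    d+e≤n = ≤-if-coef-true (coef (reciprocal (Qabc a b c))) n (d + e) recip-above
      (trans (agree (d + e)) (trans (R-high e) (binom-diag e)))

  -- The coefficient of x^{n-1} in P* vanishes since a ≥ 2; in R it is
  -- (e choose e-1) ≡ e.  Hence e is even.
  e-even : ∃ (λ m → e ≡ m * 2)
  e-even = even-if-par-false e (begin
      par e                          ≡⟨ cong par (sym e≡1+e′) ⟩
      par (suc e′)                   ≡⟨ sym (binom-codiag e′) ⟩
      binom (suc e′) e′              ≡⟨ cong (λ x → binom x e′) e≡1+e′ ⟩
      binom e e′                     ≡⟨ sym (R-high e′) ⟩
      coef R (d + e′)                ≡⟨ sym (agree (d + e′)) ⟩
      coef (reciprocal (Qabc a b c)) (d + e′)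
                                     ≡⟨ recip-gap (d + e′) s<d+e′ (subst (d + e′ <_) 1+d+e′≡n ≤-refl) ⟩
      false                          ∎)
    where
    e′ : ℕ
    e′ = e ∸ 1
    e≡1+e′ : suc e′ ≡ e
    e≡1+e′ = m+[n∸m]≡n e≥1
    1+d+e′≡n : suc (d + e′) ≡ n
    1+d+e′≡n = trans (sym (+-suc d e′)) (trans (cong (d +_) e≡1+e′) degree-sum)
    s<d+e′ : s < d + e′
    s<d+e′ = ≤-pred (≤-trans (+-monoˡ-≤ s a≥2) (≤-reflexive (sym 1+d+e′≡n)))

  d≤s : d ≤ s
  d≤s with d ≤? s
  ... | yes d≤s = d≤s
  ... | no  d≰s = ⊥-elim (false≢true (begin
      false                                 ≡⟨ sym (recip-gap d (≰⇒> d≰s) d<n) ⟩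
      coef (reciprocal (Qabc a b c)) d      ≡⟨ agree d ⟩
      coef R d                              ≡⟨ cong (coef R) (sym (+-identityʳ d)) ⟩
      coef R (d + 0)                        ≡⟨ R-high 0 ⟩
      true                                  ∎))
    where
    d<n : d < n
    d<n = subst (d <_) degree-sum (m<m+n d e≥1)

  S-after-d : ∀ j → d + j ≤ s → coef S (d + j) ≡ binom e j
  S-after-d j d+j≤s = trans (S-agree (d + j) d+j≤s) (R-high j)

  S-at-d : coef S d ≡ true
  S-at-d = trans (cong (coef S) (sym (+-identityʳ d))) (S-after-d 0 (subst (_≤ s) (sym (+-identityʳ d)) d≤s))

  S-below-d : ∀ k → 1 ≤ k → k < d → coef S k ≡ false
  S-below-d k k≥1 k<d = trans (S-agree k (≤-trans (<⇒≤ k<d) d≤s)) (R-low k k≥1 k<d)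

  S-mirror-d : coef S (s ∸ d) ≡ true
  S-mirror-d = trans (proj₂ (proj₂ pal) (s ∸ d) d (m∸n+n≡m d≤s)) S-at-d

  -- x^{s-d} cannot lie beyond x^{2d}: there the coefficient of S is
  -- (e choose s-2d), which vanishes as e is even and s - 2d is odd.
  s<2d : s < d + d
  s<2d with d + d ≤? s
  ... | no  2d≰s = ≰⇒> 2d≰s
  ... | yes 2d≤s = ⊥-elim (false≢true (begin
      false                        ≡⟨ sym (binom-even-odd m ρ) ⟩
      binom (m * 2) (suc (ρ * 2))  ≡⟨ sym (cong₂ binom e≡2m r≡2ρ+1) ⟩
      binom e r                    ≡⟨ sym (S-after-d r (subst (_≤ s) (sym d+r≡s∸d) (m∸n≤m s d))) ⟩
      coef S (d + r)               ≡⟨ cong (coef S) d+r≡s∸d ⟩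
      coef S (s ∸ d)               ≡⟨ S-mirror-d ⟩
      true                         ∎))
    where
    r : ℕ
    r = s ∸ d ∸ d
    d≤s∸d : d ≤ s ∸ d
    d≤s∸d = +-cancelʳ-≤ d d (s ∸ d) (subst (d + d ≤_) (sym (m∸n+n≡m d≤s)) 2d≤s)
    d+r≡s∸d : d + r ≡ s ∸ d
    d+r≡s∸d = m+[n∸m]≡n d≤s∸d
    r-odd : ∃ (λ ρ → r ≡ suc (ρ * 2))
    r-odd = odd-minus-double r d (β + c)
      (trans (sym (+-assoc r d d)) (trans (cong (_+ d) (m∸n+n≡m d≤s∸d)) (trans (m∸n+n≡m d≤s) s-odd)))
    m : ℕ
    m = proj₁ e-even
    e≡2m : e ≡ m * 2
    e≡2m = proj₂ e-even
    ρ : ℕ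
    ρ = proj₁ r-odd
    r≡2ρ+1 : r ≡ suc (ρ * 2)
    r≡2ρ+1 = proj₂ r-odd

  -- So 0 ≤ s - d < d, and S has no term x^k with 0 < k < d: hence s = d.
  s≡d : s ≡ d
  s≡d with s ∸ d ≟ 0
  ... | yes s∸d≡0 = ≤-antisym (m∸n≡0⇒m≤n s∸d≡0) d≤s
  ... | no  s∸d≢0 = ⊥-elim (false≢true (trans (sym (S-below-d (s ∸ d) (n≢0⇒n>0 s∸d≢0) s∸d<d)) S-mirror-d))
    where
    s∸d<d : s ∸ d < d
    s∸d<d = +-cancelʳ-< d (s ∸ d) d (subst (_< d + d) (sym (m∸n+n≡m d≤s)) s<2d)

  e≡a : e ≡ a
  e≡a = +-cancelˡ-≡ d e a (trans degree-sum (trans (cong (a +_) s≡d) (+-comm a d)))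

  -- Between x^d = x^s and x^n all coefficients of P* vanish.
  e-power-of-two : ∃ (λ r → e ≡ 2 ^ r)
  e-power-of-two = power-of-two e e≥1 middle
    where
    middle : ∀ j → 0 < j → j < e → binom e j ≡ false
    middle j 0<j j<e = trans (sym (R-high j)) (trans (sym (agree (d + j)))
      (recip-gap (d + j) (subst (_< d + j) (sym s≡d) (m<m+n d 0<j)) (subst (d + j <_) degree-sum (+-monoʳ-< d j<e))))

  -- S = (x+1)·T with T = (x+1)^{2β} Q^c; as S = 1 + x^s, T = 1 + x + … + x^{s-1}.
  T : F2Poly
  T = X⊕1 ^^ (β * 2) ⊗ Q ^^ c

  S≡mulX⊕1-T : ∀ k → coef S k ≡ mulX⊕1 (coef T) k
  S≡mulX⊕1-T k = trans (cong (λ x → coef (X⊕1 ^^ x ⊗ Q ^^ c) k) b-odd)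
    (trans (coef-⊗-assoc X⊕1 (X⊕1 ^^ (β * 2)) (Q ^^ c) k) (coef-X⊕1⊗ T k))

  T-ones : ∀ k → k < s → coef T k ≡ true
  T-ones zero    _     = trans (sym (xor-identityʳ (coef T 0)))
    (trans (sym (S≡mulX⊕1-T 0)) (trans (proj₂ (proj₂ pal) 0 s refl) (proj₁ pal)))
  T-ones (suc k) 1+k<s = x⊕1≡0⇒x≡1 (coef T (suc k)) (begin
      coef T (suc k) xor true       ≡⟨ cong (coef T (suc k) xor_) (sym (T-ones k (<-trans (n<1+n k) 1+k<s))) ⟩
      mulX⊕1 (coef T) (suc k)       ≡⟨ sym (S≡mulX⊕1-T (suc k)) ⟩
      coef S (suc k)                ≡⟨ S-below-d (suc k) (s≤s z≤n) (subst (suc k <_) s≡d 1+k<s) ⟩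
      false                         ∎)
    where
    x⊕1≡0⇒x≡1 : ∀ x → x xor true ≡ false → x ≡ true
    x⊕1≡0⇒x≡1 true  _ = refl
    x⊕1≡0⇒x≡1 false ()

  s≡1+deg-T : s ≡ suc (β * 2 + c * 2)
  s≡1+deg-T = cong (_+ c * 2) b-odd

  T-above : ∀ k → s ≤ k → coef T k ≡ false
  T-above k s≤k = proj₁ (proj₂ (palindrome-S (β * 2) c)) k (subst (_≤ k) s≡1+deg-T s≤k)

  -- T(1) = s mod 2 = 1, while (x+1)^{2β}(1) = 0 unless β = 0.
  β≡0 : β ≡ 0
  β≡0 = *-cancelʳ-≡ β 0 2 (ev1-X⊕1^⊗ (β * 2) (Q ^^ c) (trans (ev1-ones T s T-ones T-above)
    (trans (cong par s≡1+deg-T) (cong not (trans (par-+-double (β * 2) c) (par-double β))))))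

  b≡1 : b ≡ 1
  b≡1 = trans b-odd (cong (λ x → suc (x * 2)) β≡0)

  c≡1 : c ≡ 1
  c≡1 = Q^-all-ones c c≥1 (λ k k<1+2c → begin
      coef (Q ^^ c) k        ≡⟨ sym (coef-one⊗ (Q ^^ c) k) ⟩
      coef (one ⊗ Q ^^ c) k  ≡⟨ cong (λ x → coef (X⊕1 ^^ (x * 2) ⊗ Q ^^ c) k) (sym β≡0) ⟩
      coef T k               ≡⟨ T-ones k (subst (k <_) (trans (cong (λ x → suc (x * 2 + c * 2)) (sym β≡0)) (sym s≡1+deg-T)) k<1+2c) ⟩
      true                   ∎)

  d≡3 : d ≡ 3
  d≡3 = trans (sym s≡d) (cong₂ (λ x y → x + y * 2) b≡1 c≡1)

lemma3p13 : (a b c d e : ℕ) → a ≥ 1 → b ≥ 1 → c ≥ 1 → d ≥ 1 → e ≥ 1 →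
    Irreducible (Qabc a b c) →
    reciprocal (Qabc a b c) ≈ one ⊕ (X ^^ d) ⊗ ((X ⊕ one) ^^ e) →
    2 ∣ a → ¬ (2 ∣ b) →
    b ≡ 1 × c ≡ 1 × d ≡ 3 × ∃ (λ r → a ≡ 2 ^ r × e ≡ 2 ^ r)
lemma3p13 a b c d e a≥1 _ c≥1 d≥1 e≥1 _ P*≈R 2∣a 2∤b with parity b
... | inj₁ (m , b≡2m)   = ⊥-elim (2∤b (divides m b≡2m))
... | inj₂ (β , b≡2β+1) = b≡1 , c≡1 , d≡3 , r , trans (sym e≡a) e≡2ʳ , e≡2ʳ
  where
  a≥2 : 2 ≤ a
  a≥2 = ∣⇒≤ {{>-nonZero a≥1}} 2∣a
  open Comparison a b c d e a≥2 c≥1 d≥1 e≥1 β b≡2β+1 P*≈R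
  r : ℕ
  r = proj₁ e-power-of-two
  e≡2ʳ : e ≡ 2 ^ r
  e≡2ʳ = proj₂ e-power-of-two
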